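{- Let $S$ be a set, let $\mathcal C=F^{\mathrm{LD}}_S$ be the free LD category on $S$, and let $\|\cdot\|$ be the rank function determined by a function $r:S\to\mathbb N_{>0}$. If $i,j\in\mathrm{Id}^\odot$, $u,v\in\mathfrak Z$, $\vec A\in\mathcal C^{|u|}$, $\vec B\in\mathcal C^{|v|}$ satisfy $H^i_u(\vec A)=H^j_v(\vec B)$ and $\|L^i_u(\vec A)\|=\|L^j_v(\vec B)\|$, then $u=v$, $i=j$ and $\vec A=\vec B$.
   Context: The free (unitless) LD category $F^{\mathrm{LD}}_S$ on $S$: objects are the formal binary expressions built from elements of $S$ with two operations $\otimes$ and $\odot$ (so $A_1\otimes A_2=B_1\otimes B_2$ iff $A_i=B_i$, similarly for $\odot$, and no $\otimes$-expression equals a $\odot$-expression); morphisms generated by identities and components of the associators $\alpha^{\pm1}$ (for $\otimes$), $\bar\alpha^{\pm1}$ (for $\odot$, $\bar\alpha_{A,B,C}:A\odot(B\odot C)\to(A\odot B)\odot C$), and distributors $\delta^l_{A,B,C}:A\otimes(B\odot C)\to(A\otimes B)\odot C$, $\delta^r_{A,B,C}:(A\odot B)\otimes C\to A\odot(B\otimes C)$, modulo the relations of an LD category (including eight pentagon axioms). Rank: $\|s\|=r(s)$ for $s\in S$, $\|X\otimes Y\|=\|X\odot Y\|=\|X\|+\|Y\|$. $\mathrm{Id}^\odot$: identity morphisms of objects of the form $X\odot Y$. $\mathfrak Z$ is the free monoid on letters $\bar\alpha,\bar\alpha^{ -1},\delta^l,\delta^r$. For $f:H\to L\odot R$ and $u\in\mathfrak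 Z$, with $\vec A_{\ge k}=(A_k,\dots)$, $\vec A_{\le k}=(A_1,\dots,A_k)$: $H^f_\emptyset=H,L^f_\emptyset=L,R^f_\emptyset=R$; $H^f_{\bar\alpha u}(\vec A)=A_1\odot H^f_u(\vec A_{\ge2})$, $L^f_{\bar\alpha u}(\vec A)=A_1\odot L^f_u(\vec A_{\ge2})$, $R^f_{\bar\alpha u}(\vec A)=R^f_u(\vec A_{\ge2})$; $H^f_{\bar\alpha^{ -1}u}(\vec A)=H^f_u(\vec A_{\le|u|})\odot A_{|u|+1}$, $L^f_{\bar\alpha^{ -1}u}(\vec A)=L^f_u(\vec A_{\le|u|})$, $R^f_{\bar\alpha^{ -1}u}(\vec A)=R^f_u(\vec A_{\le|u|})\odot A_{|u|+1}$; $H^f_{\delta^lu}(\vec A)=A_1\otimes H^f_u(\vec A_{\ge2})$, $L^f_{\delta^lu}(\vec A)=A_1\otimes L^f_u(\vec A_{\ge2})$, $R^f_{\delta^lu}(\vec A)=R^f_u(\vec A_{\ge2})$; $H^f_{\delta^ru}(\vec A)=H^f_u(\vec A_{\le|u|})\otimes A_{|u|+1}$, $L^f_{\delta^ru}(\vec A)=L^f_u(\vec A_{\le|u|})$, $R^f_{\delta^ru}(\vec A)=R^f_u(\vec A_{\le|u|})\otimes A_{|u|+1}$. -}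

module Defs where

open import Data.Nat using (ℕ; suc; _+_)
open import Data.List using (List; []; _∷_; length)
open import Data.Vec using (Vec; _∷_; init; last)
open import Data.Product using (_×_; _,_; proj₁; proj₂)

-- Objects of the free (unitless) LD category F^LD_S: formal binary
-- expressions over S with two operations ⊗ and ⊙ (free syntax, so the
-- injectivity / disjointness conditions hold by construction).
data Obj (S : Set) : Set where
  var : S → Obj S
  _⊗_ : Obj S → Obj S → Obj S
  _⊙_ : Obj S → Obj S → Obj S

rank : {S : Set} → (S → ℕ) → Obj S → ℕ
rank r (var s) = r s
rank r (X ⊗ Y) = rank r X + rank r Y
rank r (X ⊙ Y) = rank r X + rank r Y

data Letter : Set where
  ᾱ ᾱ⁻¹ δˡ δʳ : Letter

𝔷 : Set
𝔷 = List Letter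

-- Id^⊙: the identity morphism id_{X ⊙ Y} of an object of the form X ⊙ Y.
-- Such an identity is determined by (and determines) the pair (X , Y);
-- we represent it by that pair.
IdOdot : Set → Set
IdOdot S = Obj S × Obj S

Hf Lf Rf : {S : Set} → IdOdot S → Obj S
Hf (X , Y) = X ⊙ Y
Lf (X , Y) = X
Rf (X , Y) = Y

H L R : {S : Set} → IdOdot S → (u : 𝔷) → Vec (Obj S) (length u) → Obj S
H f []        _       = Hf f
H f (ᾱ ∷ u)   (A ∷ As) = A ⊙ H f u As
H f (ᾱ⁻¹ ∷ u) As      = H f u (init As) ⊙ last As
H f (δˡ ∷ u)  (A ∷ As) = A ⊗ H f u As
H f (δʳ ∷ u)  As      = H f u (init As) ⊗ last As

L f []        _       = Lf f
L f (ᾱ ∷ u)   (A ∷ As) = A ⊙ L f u As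
L f (ᾱ⁻¹ ∷ u) As      = L f u (init As)
L f (δˡ ∷ u)  (A ∷ As) = A ⊗ L f u As
L f (δʳ ∷ u)  As      = L f u (init As)

R f []        _       = Rf f
R f (ᾱ ∷ u)   (A ∷ As) = R f u As
R f (ᾱ⁻¹ ∷ u) As      = R f u (init As) ⊙ last As
R f (δˡ ∷ u)  (A ∷ As) = R f u As
R f (δʳ ∷ u)  As      = R f u (init As) ⊗ last As

{-# OPTIONS --safe #-}
-- Since ranks are positive, ‖L^f_u‖ < ‖H^f_u‖ for every u. Hence the outermost
-- operation of H^f_u together with the comparison of ‖L^f_u‖ with the rank of its
-- left operand recovers the first letter of u: equality means u is empty, a larger
-- ‖L‖ means ᾱ or δˡ, a smaller one ᾱ⁻¹ or δʳ. Peeling that letter off both sides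
-- (cancelling the rank of the prepended argument) gives the claim by induction on u.
module Submission where

open import Defs
open import Data.Bool using (if_then_else_)
open import Data.List using (List; []; _∷_; length; head)
open import Data.Maybe using (Maybe; just; nothing)
open import Data.Nat using (ℕ; suc; _<_; _<?_)
open import Data.Nat.Properties
  using (<-irrefl; <-asym; <-≤-trans; m≤m+n; m<m+n; +-monoʳ-<; +-cancelˡ-≡)
open import Data.Product using (Σ; _×_; _,_; proj₁; proj₂)
open import Data.Product.Properties using (Σ-≡,≡←≡)
open import Data.Vec using (Vec; []; _∷_; init; last; initLast; _∷ʳ_)
open import Relation.Nullary.Decidable using (does; dec-true; dec-false)
open import Relation.Binary.PropositionalEquality
open ≡-Reasoning

⊙-injectiveˡ : {S : Set} {X Y X′ Y′ : Obj S} → X ⊙ Y ≡ X′ ⊙ Y′ → X ≡ X′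
⊙-injectiveˡ refl = refl

⊙-injectiveʳ : {S : Set} {X Y X′ Y′ : Obj S} → X ⊙ Y ≡ X′ ⊙ Y′ → Y ≡ Y′
⊙-injectiveʳ refl = refl

⊗-injectiveˡ : {S : Set} {X Y X′ Y′ : Obj S} → X ⊗ Y ≡ X′ ⊗ Y′ → X ≡ X′
⊗-injectiveˡ refl = refl

⊗-injectiveʳ : {S : Set} {X Y X′ Y′ : Obj S} → X ⊗ Y ≡ X′ ⊗ Y′ → Y ≡ Y′
⊗-injectiveʳ refl = refl

init-last-injective : {X : Set} {n : ℕ} (xs ys : Vec X (suc n)) →
  init xs ≡ init ys → last xs ≡ last ys → xs ≡ ys
init-last-injective xs ys init≡ last≡ = begin
  xs                  ≡⟨ proj₂ (proj₂ (initLast xs)) ⟩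
  init xs ∷ʳ last xs  ≡⟨ cong₂ _∷ʳ_ init≡ last≡ ⟩
  init ys ∷ʳ last ys  ≡⟨ proj₂ (proj₂ (initLast ys)) ⟨
  ys                  ∎

data SameHead {X : Set} : List X → List X → Set where
  [] : SameHead [] []
  cons : ∀ x {xs ys} → SameHead (x ∷ xs) (x ∷ ys)

sameHead : {X : Set} (xs ys : List X) → head xs ≡ head ys → SameHead xs ys
sameHead []       []        _    = []
sameHead (x ∷ xs) (.x ∷ ys) refl = cons x

byOrder : {X : Set} → ℕ → ℕ → X → X → X → X
byOrder m n lt eq gt = if does (m <? n) then lt else if does (n <? m) then gt else eq

module _ {X : Set} {lt eq gt : X} where

  byOrder-< : ∀ {m n} → m < n → byOrder m n lt eq gt ≡ lt
  byOrder-< {m} {n} m<n rewrite dec-true (m <? n) m<n = refl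

  byOrder-≡ : ∀ n → byOrder n n lt eq gt ≡ eq
  byOrder-≡ n rewrite dec-false (n <? n) (<-irrefl refl) = refl

  byOrder-> : ∀ {m n} → n < m → byOrder m n lt eq gt ≡ gt
  byOrder-> {m} {n} n<m
    rewrite dec-false (m <? n) (<-asym n<m) | dec-true (n <? m) n<m = refl

HInput : Set → Set
HInput S = IdOdot S × Σ 𝔷 (λ u → Vec (Obj S) (length u))

module _ {S : Set} {i j : IdOdot S} {u v : 𝔷} {x : Letter} where

  prepend-≡ : {A : Vec (Obj S) (length u)} {B : Vec (Obj S) (length v)} {a : Obj S} →
    _≡_ {A = HInput S} (i , u , A) (j , v , B) →
    _≡_ {A = HInput S} (i , x ∷ u , a ∷ A) (j , x ∷ v , a ∷ B)
  prepend-≡ refl = refl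

  append-≡ : {A : Vec (Obj S) (suc (length u))} {B : Vec (Obj S) (suc (length v))} →
    _≡_ {A = HInput S} (i , u , init A) (j , v , init B) → last A ≡ last B →
    _≡_ {A = HInput S} (i , x ∷ u , A) (j , x ∷ v , B)
  append-≡ {A} {B} e last≡
    with refl ← cong proj₁ e | refl , init≡ ← Σ-≡,≡←≡ (cong proj₂ e) =
    cong (λ C → i , x ∷ u , C) (init-last-injective A B init≡ last≡)

module _ {S : Set} (r : S → ℕ) where

  -- The values at var and at ⊗ with equal ranks are junk: no H^f_u has that shape.
  firstLetter : ℕ → Obj S → Maybe Letter
  firstLetter n (var _) = nothing
  firstLetter n (P ⊙ _) = byOrder n (rank r P) (just ᾱ⁻¹) nothing (just ᾱ)
  firstLetter n (P ⊗ _) = byOrder n (rank r P) (just δʳ) nothing (just δˡ)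

  module _ (r-pos : ∀ s → 0 < r s) where

    rank-pos : (X : Obj S) → 0 < rank r X
    rank-pos (var s) = r-pos s
    rank-pos (X ⊗ Y) = <-≤-trans (rank-pos X) (m≤m+n _ _)
    rank-pos (X ⊙ Y) = <-≤-trans (rank-pos X) (m≤m+n _ _)

    rank-L<rank-H : (i : IdOdot S) (u : 𝔷) (A : Vec (Obj S) (length u)) →
      rank r (L i u A) < rank r (H i u A)
    rank-L<rank-H (X , Y) []        _       = m<m+n (rank r X) (rank-pos Y)
    rank-L<rank-H i       (ᾱ ∷ u)   (a ∷ A) = +-monoʳ-< (rank r a) (rank-L<rank-H i u A)
    rank-L<rank-H i       (ᾱ⁻¹ ∷ u) A       = <-≤-trans (rank-L<rank-H i u (init A)) (m≤m+n _ _)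
    rank-L<rank-H i       (δˡ ∷ u)  (a ∷ A) = +-monoʳ-< (rank r a) (rank-L<rank-H i u A)
    rank-L<rank-H i       (δʳ ∷ u)  A       = <-≤-trans (rank-L<rank-H i u (init A)) (m≤m+n _ _)

    firstLetter-H : (i : IdOdot S) (u : 𝔷) (A : Vec (Obj S) (length u)) →
      firstLetter (rank r (L i u A)) (H i u A) ≡ head u
    firstLetter-H (X , _) []        _       = byOrder-≡ (rank r X)
    firstLetter-H i       (ᾱ ∷ u)   (a ∷ A) = byOrder-> (m<m+n (rank r a) (rank-pos (L i u A)))
    firstLetter-H i       (ᾱ⁻¹ ∷ u) A       = byOrder-< (rank-L<rank-H i u (init A))
    firstLetter-H i       (δˡ ∷ u)  (a ∷ A) = byOrder-> (m<m+n (rank r a) (rank-pos (L i u A)))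
    firstLetter-H i       (δʳ ∷ u)  A       = byOrder-< (rank-L<rank-H i u (init A))

    head-determined : (i j : IdOdot S) (u v : 𝔷)
      (A : Vec (Obj S) (length u)) (B : Vec (Obj S) (length v)) →
      H i u A ≡ H j v B → rank r (L i u A) ≡ rank r (L j v B) → head u ≡ head v
    head-determined i j u v A B H≡ ‖L‖≡ = begin
      head u                                     ≡⟨ firstLetter-H i u A ⟨
      firstLetter (rank r (L i u A)) (H i u A)   ≡⟨ cong₂ firstLetter ‖L‖≡ H≡ ⟩
      firstLetter (rank r (L j v B)) (H j v B)   ≡⟨ firstLetter-H j v B ⟩
      head v                                     ∎

    H-rankL-injective : (i j : IdOdot S) (u v : 𝔷)
      (A : Vec (Obj S) (length u)) (B : Vec (Obj S) (length v)) →
      H i u A ≡ H j v B → rank r (L i u A) ≡ rank r (L j v B) →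
      _≡_ {A = HInput S} (i , u , A) (j , v , B)
    H-rankL-injective i j u v A B H≡ ‖L‖≡
      with sameHead u v (head-determined i j u v A B H≡ ‖L‖≡)
    H-rankL-injective (X , Y) _ [] [] [] [] refl _ | [] = refl
    H-rankL-injective i j (ᾱ ∷ u) (ᾱ ∷ v) (a ∷ A) (b ∷ B) H≡ ‖L‖≡ | cons _
      with refl ← ⊙-injectiveˡ H≡ =
      prepend-≡ (H-rankL-injective i j u v A B (⊙-injectiveʳ H≡)
                                   (+-cancelˡ-≡ (rank r a) _ _ ‖L‖≡))
    H-rankL-injective i j (δˡ ∷ u) (δˡ ∷ v) (a ∷ A) (b ∷ B) H≡ ‖L‖≡ | cons _
      with refl ← ⊗-injectiveˡ H≡ =
      prepend-≡ (H-rankL-injective i j u v A B (⊗-injectiveʳ H≡)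
                                   (+-cancelˡ-≡ (rank r a) _ _ ‖L‖≡))
    H-rankL-injective i j (ᾱ⁻¹ ∷ u) (ᾱ⁻¹ ∷ v) A B H≡ ‖L‖≡ | cons _ =
      append-≡ (H-rankL-injective i j u v (init A) (init B) (⊙-injectiveˡ H≡) ‖L‖≡)
               (⊙-injectiveʳ H≡)
    H-rankL-injective i j (δʳ ∷ u) (δʳ ∷ v) A B H≡ ‖L‖≡ | cons _ =
      append-≡ (H-rankL-injective i j u v (init A) (init B) (⊗-injectiveˡ H≡) ‖L‖≡)
               (⊗-injectiveʳ H≡)

lemma5p5 : {S : Set} (r : S → ℕ) → (∀ s → 0 < r s) →
    (i j : IdOdot S) (u v : 𝔷)
    (A : Vec (Obj S) (length u)) (B : Vec (Obj S) (length v)) →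
    H i u A ≡ H j v B →
    rank r (L i u A) ≡ rank r (L j v B) →
    Σ (u ≡ v) (λ e → i ≡ j × subst (λ w → Vec (Obj S) (length w)) e A ≡ B)
lemma5p5 r r-pos i j u v A B H≡ ‖L‖≡ =
  let input≡ = H-rankL-injective r r-pos i j u v A B H≡ ‖L‖≡
      u≡v , A≡B = Σ-≡,≡←≡ (cong proj₂ input≡)
  in u≡v , cong proj₁ input≡ , A≡B
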